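{- Let $n,k\in\mathbb{N}$ with $n\ge3$, $k\ge2$. Then $\sigma^{\square}_V(MC_n^k)\le\left\lfloor\frac{n}{2}\right\rfloor$.
   Context: For $n\ge3$, $k\ge2$, the multilayered cycle $MC_n^k$ is the graph with vertex set $\{(i,j): i\in\mathbb{Z}_n,\ j\in\{1,\dots,k\}\}$ in which $(a,b)$ and $(c,d)$ are adjacent iff either $a=c$ and $|d-b|=1$, or $b=d$ and $a-c\equiv\pm1 \pmod n$. Write $\mathbb{N}_l=\{1,\dots,l\}$ and let $d$ denote the shortest-path distance in the graph. A lazy $l$-track on a graph $G$ is a surjective map $f:\mathbb{N}_l\to V(G)$ with $f(i)f(i+1)\in E(G)$ or $f(i)=f(i+1)$ for all $i\in\mathbb{N}_{l-1}$. Two lazy $l$-tracks $f,g$ are opposite if for every $i\in\mathbb{N}_{l-1}$: $f(i)f(i+1)\in E(G)$ if and only if $g(i)=g(i+1)$. For maps $f,g:\mathbb{N}_l\to V(G)$ set $m_G(f,g)=\min\{d(f(i),g(i)): i\in\mathbb{N}_l\}$. The Cartesian vertex span $\sigma^{\square}_V(G)$ is the maximum of $m_G(f,g)$ over all $l\in\mathbb{N}$ and all pairs $f,g$ of opposite lazy $l$-tracks on $G$. -}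

module Defs where

open import Data.Nat using (ℕ; zero; suc; _<_; _≤_; _+_)
open import Data.Nat.Properties using (<-trans; n<1+n)
open import Data.Fin using (Fin; toℕ; fromℕ<)
open import Data.Product using (_×_; ∃)
open import Data.Sum using (_⊎_)
open import Relation.Binary.PropositionalEquality using (_≡_)
open import Function.Bundles using (_⇔_)

record Graph : Set₁ where
  field
    V   : Set
    Adj : V → V → Set
open Graph public

-- SucMod n x y : toℕ y ≡ toℕ x + 1 (mod n), i.e. y - x ≡ 1 (mod n).
SucMod : (n : ℕ) → Fin n → Fin n → Set
SucMod n x y = toℕ y ≡ suc (toℕ x) ⊎ (toℕ y ≡ 0 × suc (toℕ x) ≡ n)

-- Multilayered cycle MC_n^k: vertices (i , j) with i ∈ ℤ_n (as Fin n) and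
-- j ∈ {1..k} (represented by Fin k, i.e. shifted by one).
MCAdj : (n k : ℕ) → Fin n × Fin k → Fin n × Fin k → Set
MCAdj n k (a Data.Product., b) (c Data.Product., d) =
    (a ≡ c × (toℕ d ≡ suc (toℕ b) ⊎ toℕ b ≡ suc (toℕ d)))
  ⊎ (b ≡ d × (SucMod n c a ⊎ SucMod n a c))

MC : ℕ → ℕ → Graph
MC n k = record { V = Fin n × Fin k ; Adj = MCAdj n k }

data Walk (G : Graph) : V G → V G → ℕ → Set where
  here : ∀ {u} → Walk G u u 0
  step : ∀ {u w v m} → Adj G u w → Walk G w v m → Walk G u v (suc m)

Dist : (G : Graph) → V G → V G → ℕ → Set
Dist G u v m = Walk G u v m × (∀ m′ → Walk G u v m′ → m ≤ m′)

-- Positions 1..l of ℕ_l are represented by Fin l (positions 0..l-1).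
-- "position i" and "position i+1" for suc i < l:
pos : ∀ {l} (i : ℕ) → suc i < l → Fin l
pos i p = fromℕ< (<-trans (n<1+n i) p)

pos₊ : ∀ {l} (i : ℕ) → suc i < l → Fin l
pos₊ i p = fromℕ< p

LazyTrack : (G : Graph) (l : ℕ) → (Fin l → V G) → Set
LazyTrack G l f =
    (∀ v → ∃ λ i → f i ≡ v)
  × (∀ (i : ℕ) (p : suc i < l) → Adj G (f (pos i p)) (f (pos₊ i p)) ⊎ f (pos i p) ≡ f (pos₊ i p))

Opposite : (G : Graph) (l : ℕ) → (Fin l → V G) → (Fin l → V G) → Set
Opposite G l f g =
  ∀ (i : ℕ) (p : suc i < l) → Adj G (f (pos i p)) (f (pos₊ i p)) ⇔ (g (pos i p) ≡ g (pos₊ i p))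

MinDist : (G : Graph) (l : ℕ) → (Fin l → V G) → (Fin l → V G) → ℕ → Set
MinDist G l f g m =
    (∃ λ i → Dist G (f i) (g i) m)
  × (∀ i d → Dist G (f i) (g i) d → m ≤ d)

CartVertexSpan≤ : Graph → ℕ → Set
CartVertexSpan≤ G b =
  ∀ (l : ℕ) (f g : Fin l → V G) → LazyTrack G l f → LazyTrack G l g → Opposite G l f g →
    ∀ m → MinDist G l f g m → m ≤ b

-- Let the layer of a vertex (i , j) be j.  Both tracks pass through the bottom layer,
-- and at every step one of them stays put while the other moves to a
-- neighbour, so the difference of their layers changes by at most one per
-- step: by a discrete intermediate value argument there is a time at which
-- f and g lie in the same layer.  Two vertices of one layer are joined along
-- that layer's n-cycle, one way round or the other, by a walk of length at
-- most ⌊n/2⌋, which therefore bounds m(f, g).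
module Submission where

open import Defs
open import Data.Nat using (ℕ; _≤_; _/_)
open import Data.Nat using (zero; suc; _+_; _*_; _%_; _<_; _≤′_; ≤′-refl; ≤′-step; z≤n; z<s; s≤s⁻¹; _≤?_)
open import Data.Nat.Properties
open import Data.Nat.DivMod using (m≡m%n+[m/n]*n; m%n<n)
open import Data.Nat.Induction using (<-rec)
open import Data.Nat.Tactic.RingSolver using (solve-∀)
open import Data.Fin using (Fin; toℕ; fromℕ<; fromℕ)
open import Data.Fin.Properties using (toℕ-injective; toℕ<n; toℕ-fromℕ; toℕ-fromℕ<; fromℕ<-toℕ)
open import Data.Product using (_×_; ∃; _,_; proj₁; proj₂; swap; map₂)
open import Data.Sum using (_⊎_; inj₁; inj₂; [_,_])
open import Function.Base using (_∘_)
open import Function.Bundles using (Equivalence)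
open import Relation.Nullary using (¬_; yes; no)
open import Relation.Nullary.Decidable using (decidable-stable; ¬¬-excluded-middle)
open import Relation.Nullary.Negation using (¬¬-map; contradiction)
open import Relation.Binary.PropositionalEquality using (_≡_; refl; sym; trans; cong; subst; module ≡-Reasoning)

_++ʷ_ : ∀ {G u v w a b} → Walk G u v a → Walk G v w b → Walk G u w (a + b)
here       ++ʷ W = W
step e W′ ++ʷ W = step e (W′ ++ʷ W)

reverseʷ : ∀ {G} → (∀ {u v} → Adj G u v → Adj G v u) →
           ∀ {u v m} → Walk G u v m → Walk G v u m
reverseʷ adj-sym here = here
reverseʷ adj-sym (step {m = m} e W) =
  subst (Walk _ _ _) (+-comm m 1) (reverseʷ adj-sym W ++ʷ step (adj-sym e) here)

module _ {G : Graph} {u v : V G} where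

  ShortestWithin : ℕ → Set
  ShortestWithin w = Walk G u v w → ¬ ¬ (∃ λ d → d ≤ w × Dist G u v d)

  walk⇒¬¬dist : ∀ w → ShortestWithin w
  walk⇒¬¬dist = <-rec ShortestWithin shorten
    where
    shorten : ∀ w → (∀ {w′} → w′ < w → ShortestWithin w′) → ShortestWithin w
    shorten w rec W ¬dist = ¬¬-excluded-middle {A = ∃ λ w′ → w′ < w × Walk G u v w′} λ where
      (yes (w′ , w′<w , W′)) →
        rec w′<w W′ λ (d , d≤w′ , D) → ¬dist (d , ≤-trans d≤w′ (<⇒≤ w′<w) , D)
      (no ¬shorter) →
        ¬dist (w , ≤-refl , W , λ w′ W′ → ≮⇒≥ λ w′<w → ¬shorter (w′ , w′<w , W′))

-- The existence of a shortest walk is only available doubly negated, which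
-- suffices because the conclusion is decidable.
minDist≤walk : ∀ {G l f g m} → MinDist G l f g m →
               ∀ {i w} → Walk G (f i) (g i) w → m ≤ w
minDist≤walk {m = m} (_ , m≤dist) {i} {w} W =
  decidable-stable (m ≤? w) (¬¬-map (λ (d , d≤w , D) → ≤-trans (m≤dist i d D) d≤w) (walk⇒¬¬dist w W))

NoJump : ℕ → ℕ → ℕ → ℕ → Set
NoJump a a′ b b′ = (a < b → a′ ≤ b′) × (b < a → b′ ≤ a′)

crossing-≤′ : ∀ {l} (a b : Fin l → ℕ) →
  (∀ x p → a (pos x p) < b (pos x p) → a (pos₊ x p) ≤ b (pos₊ x p)) →
  ∀ {i j} (i<l : i < l) (j<l : j < l) → i ≤′ j →
  a (fromℕ< i<l) ≤ b (fromℕ< i<l) → b (fromℕ< j<l) ≤ a (fromℕ< j<l) → ∃ λ x → a x ≡ b x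
crossing-≤′ a b forward i<l j<l ≤′-refl a≤b b≤a with ≤-irrelevant i<l j<l
... | refl = _ , ≤-antisym a≤b b≤a
crossing-≤′ a b forward i<l j<l (≤′-step i≤′j) a≤b b≤a with m≤n⇒m<n∨m≡n b≤a
... | inj₂ b≡a = _ , sym b≡a
... | inj₁ b<a = crossing-≤′ a b forward i<l (<-trans (n<1+n _) j<l) i≤′j a≤b
                   (≮⇒≥ (<⇒≱ b<a ∘ forward _ j<l))

crossing : ∀ {l} (a b : Fin l → ℕ) →
  (∀ x p → NoJump (a (pos x p)) (a (pos₊ x p)) (b (pos x p)) (b (pos₊ x p))) →
  ∀ i j → a i ≤ b i → b j ≤ a j → ∃ λ x → a x ≡ b x
crossing {l} a b noJump i j a≤b b≤a = [ forwards , backwards ] (≤-total (toℕ i) (toℕ j))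
  where
  realign : ∀ x → fromℕ< (toℕ<n x) ≡ x
  realign x = fromℕ<-toℕ x (toℕ<n x)

  a≤b-at : ∀ x → a x ≤ b x → a (fromℕ< (toℕ<n x)) ≤ b (fromℕ< (toℕ<n x))
  a≤b-at x = subst (λ y → a y ≤ b y) (sym (realign x))

  b≤a-at : ∀ x → b x ≤ a x → b (fromℕ< (toℕ<n x)) ≤ a (fromℕ< (toℕ<n x))
  b≤a-at x = subst (λ y → b y ≤ a y) (sym (realign x))

  forwards : toℕ i ≤ toℕ j → ∃ λ x → a x ≡ b x
  forwards i≤j = crossing-≤′ a b (λ x p → proj₁ (noJump x p)) (toℕ<n i) (toℕ<n j) (≤⇒≤′ i≤j)
                   (a≤b-at i a≤b) (b≤a-at j b≤a)

  backwards : toℕ j ≤ toℕ i → ∃ λ x → a x ≡ b x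
  backwards j≤i = map₂ sym (crossing-≤′ b a (λ x p → proj₂ (noJump x p)) (toℕ<n j) (toℕ<n i)
                    (≤⇒≤′ j≤i) (b≤a-at j b≤a) (a≤b-at i a≤b))

Near : ℕ → ℕ → Set
Near a b = a ≤ suc b × b ≤ suc a

near-refl : ∀ {a} → Near a a
near-refl = n≤1+n _ , n≤1+n _

near-suc : ∀ a → Near a (suc a)
near-suc a = m≤n+m a 2 , ≤-refl

near⇒noJumpˡ : ∀ {a a′ b b′} → Near a a′ → b ≡ b′ → NoJump a a′ b b′
near⇒noJumpˡ (a≤1+a′ , a′≤1+a) refl =
  (λ a<b → ≤-trans a′≤1+a a<b) , (λ b<a → s≤s⁻¹ (≤-trans b<a a≤1+a′))

near⇒noJumpʳ : ∀ {a a′ b b′} → a ≡ a′ → Near b b′ → NoJump a a′ b b′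
near⇒noJumpʳ a≡a′ near = swap (near⇒noJumpˡ near a≡a′)

layer : ∀ {n k} → Fin n × Fin k → ℕ
layer = toℕ ∘ proj₂

MCAdj-sym : ∀ {n k u v} → MCAdj n k u v → MCAdj n k v u
MCAdj-sym (inj₁ (refl , inj₁ e)) = inj₁ (refl , inj₂ e)
MCAdj-sym (inj₁ (refl , inj₂ e)) = inj₁ (refl , inj₁ e)
MCAdj-sym (inj₂ (refl , inj₁ s)) = inj₂ (refl , inj₂ s)
MCAdj-sym (inj₂ (refl , inj₂ s)) = inj₂ (refl , inj₁ s)

MCAdj⇒near-layer : ∀ {n k u v} → MCAdj n k u v → Near (layer u) (layer v)
MCAdj⇒near-layer (inj₁ (refl , inj₁ e)) = subst (Near _) (sym e) (near-suc _)
MCAdj⇒near-layer (inj₁ (refl , inj₂ e)) = swap (subst (Near _) (sym e) (near-suc _))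
MCAdj⇒near-layer (inj₂ (refl , _))     = near-refl

lazyStep⇒near-layer : ∀ {n k u v} → MCAdj n k u v ⊎ u ≡ v → Near (layer u) (layer v)
lazyStep⇒near-layer (inj₁ adj)  = MCAdj⇒near-layer adj
lazyStep⇒near-layer (inj₂ refl) = near-refl

opposite⇒noJump-layer : ∀ {n k l f g} →
  LazyTrack (MC n k) l f → LazyTrack (MC n k) l g → Opposite (MC n k) l f g →
  ∀ x p → NoJump (layer (f (pos x p))) (layer (f (pos₊ x p))) (layer (g (pos x p))) (layer (g (pos₊ x p)))
opposite⇒noJump-layer (_ , lazyf) (_ , lazyg) opp x p with lazyf x p
... | inj₁ adj  = near⇒noJumpˡ (MCAdj⇒near-layer adj) (cong layer (Equivalence.to (opp x p) adj))
... | inj₂ stay = near⇒noJumpʳ (cong layer stay) (lazyStep⇒near-layer (lazyg x p))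

module _ {n k : ℕ} (c : Fin k) where

  ascend : ∀ t {a b : Fin n} → toℕ a + t ≡ toℕ b → Walk (MC n k) (a , c) (b , c) t
  ascend zero {a} a+0≡b with toℕ-injective (trans (sym (+-identityʳ (toℕ a))) a+0≡b)
  ... | refl = here
  ascend (suc t) {a} {b} a+t≡b =
    step (inj₂ (refl , inj₂ (inj₁ (toℕ-fromℕ< 1+a<n))))
         (ascend t (trans (cong (_+ t) (toℕ-fromℕ< 1+a<n)) (trans (sym (+-suc (toℕ a) t)) a+t≡b)))
    where
    1+a<n : suc (toℕ a) < n
    1+a<n = ≤-<-trans (m<m+n (toℕ a) z<s) (subst (_< n) (sym a+t≡b) (toℕ<n b))

  descend : ∀ t {a b : Fin n} → toℕ b + t ≡ toℕ a → Walk (MC n k) (a , c) (b , c) t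
  descend t b+t≡a = reverseʷ MCAdj-sym (ascend t b+t≡a)

wrap : ∀ {n k} (c : Fin k) → MCAdj (suc n) k (Fin.zero , c) (fromℕ n , c)
wrap {n} c = inj₂ (refl , inj₁ (inj₂ (refl , cong suc (toℕ-fromℕ n))))

around : ∀ {n k} (c : Fin k) {a b : Fin (suc n)} d → toℕ a + d ≡ toℕ b →
         ∃ λ L → L + d ≡ suc n × Walk (MC (suc n) k) (a , c) (b , c) L
around {n} c {a} {b} d a+d≡b with m≤n⇒∃[o]m+o≡n (s≤s⁻¹ (toℕ<n b))
... | e , b+e≡n =
  toℕ a + suc e , length ,
  descend c (toℕ a) refl ++ʷ step (wrap c) (descend c e (trans b+e≡n (sym (toℕ-fromℕ n))))
  where
  length : toℕ a + suc e + d ≡ suc n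
  length = begin
    toℕ a + suc e + d   ≡⟨ rearrange (toℕ a) e d ⟩
    suc (toℕ a + d + e) ≡⟨ cong (λ x → suc (x + e)) a+d≡b ⟩
    suc (toℕ b + e)     ≡⟨ cong suc b+e≡n ⟩
    suc n               ∎
    where
    open ≡-Reasoning
    rearrange : ∀ a e d → a + suc e + d ≡ suc (a + d + e)
    rearrange = solve-∀

n<2[1+n/2] : ∀ n → n < suc (n / 2) + suc (n / 2)
n<2[1+n/2] n = begin-strict
  n                         ≡⟨ m≡m%n+[m/n]*n n 2 ⟩
  n % 2 + n / 2 * 2         <⟨ +-monoˡ-< (n / 2 * 2) (m%n<n n 2) ⟩
  2 + n / 2 * 2             ≡⟨ double (n / 2) ⟩
  suc (n / 2) + suc (n / 2) ∎
  where
  open ≤-Reasoning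
  double : ∀ h → 2 + h * 2 ≡ suc h + suc h
  double = solve-∀

summand≤half : ∀ {x y n} → x + y ≡ n → x ≤ n / 2 ⊎ y ≤ n / 2
summand≤half {x} {y} {n} x+y≡n with x ≤? n / 2 | y ≤? n / 2
... | yes x≤ | _      = inj₁ x≤
... | no _   | yes y≤ = inj₂ y≤
... | no x≰  | no y≰  = contradiction
  (subst (n <_) x+y≡n (<-≤-trans (n<2[1+n/2] n) (+-mono-≤ (≰⇒> x≰) (≰⇒> y≰)))) (<-irrefl refl)

ordered⇒walk≤n/2 : ∀ {n k} (c : Fin k) {a b : Fin (suc n)} → toℕ a ≤ toℕ b →
                   ∃ λ L → L ≤ suc n / 2 × Walk (MC (suc n) k) (a , c) (b , c) L
ordered⇒walk≤n/2 c {a} a≤b with m≤n⇒∃[o]m+o≡n a≤b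
... | d , a+d≡b with around c d a+d≡b
... | L , L+d≡n , W with summand≤half L+d≡n
...   | inj₁ L≤ = L , L≤ , W
...   | inj₂ d≤ = d , d≤ , ascend c d a+d≡b

sameLayer⇒walk≤n/2 : ∀ {n k} (u v : Fin (suc n) × Fin k) → layer u ≡ layer v →
                     ∃ λ L → L ≤ suc n / 2 × Walk (MC (suc n) k) u v L
sameLayer⇒walk≤n/2 (a , c) (b , c′) same with toℕ-injective same | ≤-total (toℕ a) (toℕ b)
... | refl | inj₁ a≤b = ordered⇒walk≤n/2 c a≤b
... | refl | inj₂ b≤a = map₂ (map₂ (reverseʷ MCAdj-sym)) (ordered⇒walk≤n/2 c b≤a)

visits-layer₀ : ∀ {n k l h} → LazyTrack (MC (suc n) (suc k)) l h → ∃ λ i → layer (h i) ≡ 0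
visits-layer₀ (onto , _) = map₂ (cong layer) (onto (Fin.zero , Fin.zero))

tracks-meet-in-a-layer : ∀ {n k l f g} →
  LazyTrack (MC (suc n) (suc k)) l f → LazyTrack (MC (suc n) (suc k)) l g →
  Opposite (MC (suc n) (suc k)) l f g → ∃ λ x → layer (f x) ≡ layer (g x)
tracks-meet-in-a-layer {f = f} {g} trackf trackg opp =
  let i , fi≡0 = visits-layer₀ trackf
      j , gj≡0 = visits-layer₀ trackg
  in crossing (layer ∘ f) (layer ∘ g) (opposite⇒noJump-layer trackf trackg opp) i j
       (≡0⇒≤ fi≡0) (≡0⇒≤ gj≡0)
  where
  ≡0⇒≤ : ∀ {x y} → x ≡ 0 → x ≤ y
  ≡0⇒≤ refl = z≤n

span≤half : ∀ n k → CartVertexSpan≤ (MC (suc n) (suc k)) (suc n / 2)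
span≤half n k l f g trackf trackg opp m minDist =
  let x , same = tracks-meet-in-a-layer trackf trackg opp
      L , L≤n/2 , W = sameLayer⇒walk≤n/2 (f x) (g x) same
  in ≤-trans (minDist≤walk minDist W) L≤n/2

lemma2 : (n k : ℕ) → 3 ≤ n → 2 ≤ k → CartVertexSpan≤ (MC n k) (n / 2)
lemma2 (suc n) (suc k) _ _ = span≤half n k
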